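{- Let $\Sigma$ be a finite alphabet and $L,N\ge1$. For any two distinct datasets $S_1\neq S_2$ with $S_1,S_2\subseteq\Sigma^L$ and $|S_1|=|S_2|=N$, there exists a query $q\in\Sigma^L$ such that $\mathrm{top}\text{ - }1(q,S_1)\neq\mathrm{top}\text{ - }1(q,S_2)$.
   Context: For $s,t\in\Sigma^L$, $\mathrm{LCP}(s,t)=\max\{j : s[1..j]=t[1..j]\}$. For a dataset $S$ and query $q$, $\mathrm{top}\text{ - }1(q,S)$ is the element $s\in S$ maximizing $\mathrm{LCP}(q,s)$, with ties broken by a fixed index ordering of the items. -}

module Defs where

open import Data.Nat using (ℕ; zero; suc; _<ᵇ_)
open import Data.Fin using (Fin)
open import Data.Fin.Properties using (_≟_)
open import Data.Vec using (Vec; []; _∷_)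
open import Data.Bool using (if_then_else_)
open import Relation.Nullary using (yes; no)

Str : ℕ → ℕ → Set
Str k L = Vec (Fin k) L

LCP : ∀ {k L} → Str k L → Str k L → ℕ
LCP [] [] = zero
LCP (x ∷ xs) (y ∷ ys) with x ≟ y
... | yes _ = suc (LCP xs ys)
... | no  _ = zero

-- A dataset of N items is a vector of N strings (its index ordering is the
-- position in the vector).  top-1 returns the item maximizing LCP with q,
-- ties broken in favour of the smallest index.
top1 : ∀ {k L n} → Str k L → Vec (Str k L) (suc n) → Str k L
top1 q (s ∷ []) = s
top1 q (s ∷ t ∷ rest) =
  let r = top1 q (t ∷ rest) in
  if LCP q s <ᵇ LCP q r then r else s

{-# OPTIONS --safe #-}
-- If x belongs to S₁ but not to S₂, use x itself as the query.  x is the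
-- only string whose common prefix with x has full length L, so top-1 over S₁
-- returns x, whereas top-1 over S₂ returns an item of S₂, which is not x.
-- Datasets that differ as sets have such an x on one side or the other.
module Submission where

open import Defs
open import Data.Nat using (ℕ; suc; _≤_; _<ᵇ_; z≤n; s≤s)
open import Data.Nat.Properties using (≤-refl; ≤-trans; <⇒≤; ≮⇒≥; <ᵇ-reflects-<)
open import Data.Fin.Properties using (_≟_)
open import Data.Vec using (Vec; []; _∷_)
open import Data.Vec.Properties using (≡-dec)
open import Data.Vec.Membership.Propositional using (_∈_; _∉_)
open import Data.Vec.Relation.Unary.Any using (here; there; any?)
open import Data.Vec.Relation.Unary.Unique.Propositional using (Unique)
open import Data.Bool using (true; false)
open import Data.Empty using (⊥-elim)
open import Data.Product using (Σ; ∃; _×_; _,_)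
open import Data.Sum using (_⊎_; inj₁; inj₂)
open import Function using (_∘_)
open import Function.Bundles using (_⇔_; mk⇔)
open import Relation.Binary.Definitions using (DecidableEquality)
open import Relation.Binary.PropositionalEquality using (_≡_; _≢_; refl; sym; trans; cong; subst)
open import Relation.Nullary using (¬_; yes; no)
open import Relation.Nullary.Decidable using (¬?; decidable-stable)
open import Relation.Nullary.Reflects using (ofʸ; ofⁿ)

module _ {a} {A : Set a} (_≟ᴬ_ : DecidableEquality A) where
  open import Data.Vec.Membership.DecPropositional _≟ᴬ_ using (_∈?_; find; lose)

  ∈-∉-or-⊆ : ∀ {m n} (xs : Vec A m) (ys : Vec A n) →
    (∃ λ x → x ∈ xs × x ∉ ys) ⊎ (∀ {x} → x ∈ xs → x ∈ ys)
  ∈-∉-or-⊆ xs ys with any? (λ x → ¬? (x ∈? ys)) xs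
  ... | yes some = inj₁ (find some)
  ... | no none  = inj₂ λ {x} x∈xs →
    decidable-stable (x ∈? ys) (λ x∉ys → none (lose x∈xs x∉ys))

module _ {k : ℕ} where

  LCP-self : ∀ {L} (q : Str k L) → L ≤ LCP q q
  LCP-self []       = z≤n
  LCP-self (x ∷ xs) with x ≟ x
  ... | yes _   = s≤s (LCP-self xs)
  ... | no x≢x = ⊥-elim (x≢x refl)

  length≤LCP⇒≡ : ∀ {L} (q s : Str k L) → L ≤ LCP q s → q ≡ s
  length≤LCP⇒≡ []       []       _ = refl
  length≤LCP⇒≡ (x ∷ xs) (y ∷ ys) L≤lcp with x ≟ y | L≤lcp
  ... | yes refl | s≤s L≤lcp′ = cong (x ∷_) (length≤LCP⇒≡ xs ys L≤lcp′)

  module _ {L : ℕ} (q : Str k L) where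

    top1-∈ : ∀ {n} (S : Vec (Str k L) (suc n)) → top1 q S ∈ S
    top1-∈ (s ∷ [])       = here refl
    top1-∈ (s ∷ t ∷ rest) with LCP q s <ᵇ LCP q (top1 q (t ∷ rest))
    ... | true  = there (top1-∈ (t ∷ rest))
    ... | false = here refl

    top1-maximal : ∀ {n x} (S : Vec (Str k L) (suc n)) → x ∈ S →
      LCP q x ≤ LCP q (top1 q S)
    top1-maximal (s ∷ []) (here refl) = ≤-refl
    top1-maximal (s ∷ t ∷ rest) x∈S
      with LCP q s <ᵇ LCP q (top1 q (t ∷ rest))
         | <ᵇ-reflects-< (LCP q s) (LCP q (top1 q (t ∷ rest)))
         | x∈S
    ... | true  | ofʸ s<r | here refl  = <⇒≤ s<r
    ... | true  | ofʸ _   | there x∈ts = top1-maximal (t ∷ rest) x∈ts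
    ... | false | ofⁿ _   | here refl  = ≤-refl
    ... | false | ofⁿ s≮r | there x∈ts =
      ≤-trans (top1-maximal (t ∷ rest) x∈ts) (≮⇒≥ s≮r)

    top1-self : ∀ {n} (S : Vec (Str k L) (suc n)) → q ∈ S → top1 q S ≡ q
    top1-self S q∈S =
      sym (length≤LCP⇒≡ q (top1 q S) (≤-trans (LCP-self q) (top1-maximal S q∈S)))

  top1-separates : ∀ {L n x} {S₁ S₂ : Vec (Str k L) (suc n)} →
    x ∈ S₁ → x ∉ S₂ → top1 x S₁ ≢ top1 x S₂
  top1-separates {x = x} {S₁} {S₂} x∈S₁ x∉S₂ same =
    x∉S₂ (subst (_∈ S₂) (trans (sym same) (top1-self x S₁ x∈S₁)) (top1-∈ x S₂))

mainTheorem10 : (k L n : ℕ) → 1 ≤ L →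
    (S₁ S₂ : Vec (Str k L) (suc n)) → Unique S₁ → Unique S₂ →
    ¬ (∀ x → (x ∈ S₁) ⇔ (x ∈ S₂)) →
    Σ (Str k L) (λ q → top1 q S₁ ≢ top1 q S₂)
mainTheorem10 k L n _ S₁ S₂ _ _ S₁≉S₂
  with ∈-∉-or-⊆ (≡-dec _≟_) S₁ S₂ | ∈-∉-or-⊆ (≡-dec _≟_) S₂ S₁
... | inj₁ (x , x∈S₁ , x∉S₂) | _                      = x , top1-separates x∈S₁ x∉S₂
... | inj₂ _                 | inj₁ (x , x∈S₂ , x∉S₁) = x , top1-separates x∈S₂ x∉S₁ ∘ sym
... | inj₂ S₁⊆S₂             | inj₂ S₂⊆S₁             = ⊥-elim (S₁≉S₂ λ _ → mk⇔ S₁⊆S₂ S₂⊆S₁)
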